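{- Let $\Gamma$ be a triangulation of a connected closed $2$-dimensional surface and let $F,F'$ be adjacent faces (sharing an edge) whose $z$-monodromies $M_F$ and $M_{F'}$ are both the identity. Then there is a unique (up to reversal) zigzag whose face shadow contains $F$ and $F'$, and (for a suitable choice among this zigzag and its reverse) its face shadow is a cyclic sequence of the form $$F,F',\dots,F',\dots,F',F,\dots,F,\dots,$$ where the dots denote segments containing neither $F$ nor $F'$ (the reversed zigzag then has face shadow $F',F,\dots,F,\dots,F,F',\dots,F',\dots$).
   Context: A triangulation of a surface $M$ is a closed $2$-cell embedding of a finite connected graph in $M$ such that every face contains exactly three edges, every edge lies in exactly two distinct faces, and the intersection of two distinct faces is an edge, a vertex, or empty. A zigzag is a sequence of edges $\{e_i\}$ such that for every $i$: $e_i,e_{i+1}$ share a vertex and lie in a common face; the faces containing $e_i,e_{i+1}$ and $e_{i+1},e_{i+2}$ are distinct, and $e_i,e_{i+2}$ are disjoint; it is cyclic, written $e_1,\dots,e_n$ with minimal period $n$, traverses each of its edges in a definite direction, and is determined by any two consecutive oriented edges. Its face shadow is the cyclic sequence $F_1,\dots,F_n$ with $F_i$ the face containing $e_i,e_{i+1}$. For a face $F$ with vertices $a,b,c$, $\Omega(F)=\{ab,bc,ca,ac,cb,ba\}$ is its set of oriented edges and $D_F=(ab,bc,ca)(ac,cb,ba)$. The $z$-monodromy $M_F$ is the permutation of $\Omega(F)$ given by: for $e\in\Omega(F)$ take $e_0$ with $D_F(e_0)=e$, follow the zigzag containing the consecutive oriented edges $e_0,e$, and let $M_F(e)$ be the first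 element of $\Omega(F)$ occurring in this zigzag after $e$. -}

module Defs where

open import Data.Nat using (ℕ; zero; suc; _<_; _≤_)
open import Data.Integer as ℤ using (ℤ; +_; -_)
open import Data.Fin using (Fin)
open import Data.Fin.Subset using (Subset; ⁅_⁆; _∪_; ∣_∣; _∈_)
open import Data.Product using (Σ; ∃; ∃₂; _×_; _,_)
open import Data.Sum using (_⊎_)
open import Relation.Binary.PropositionalEquality using (_≡_; _≢_)
open import Relation.Nullary using (¬_)
open import Relation.Binary.Construct.Closure.ReflexiveTransitive using (Star)

-- Vertices are Fin n; a face is a 3-element vertex set (Subset n).

tri : ∀ {n} → Fin n → Fin n → Fin n → Subset n
tri a b c = ⁅ a ⁆ ∪ (⁅ b ⁆ ∪ ⁅ c ⁆)

module _ {n : ℕ} (IsFace : Subset n → Set) where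

  -- u and w lie on a common face (graph adjacency, reflexive is harmless
  -- for connectivity)
  Adj : Fin n → Fin n → Set
  Adj u w = ∃ λ F → IsFace F × u ∈ F × w ∈ F

  LinkVertex : Fin n → Fin n → Set
  LinkVertex v u = u ≢ v × Adj v u

  LinkAdj : Fin n → Fin n → Fin n → Set
  LinkAdj v u w = IsFace (tri v u w)

  EdgeInTwoFaces : Fin n → Fin n → Set
  EdgeInTwoFaces u w =
    ∃₂ λ F G → F ≢ G × IsFace F × IsFace G
      × (u ∈ F × w ∈ F) × (u ∈ G × w ∈ G)
      × (∀ H → IsFace H → u ∈ H → w ∈ H → H ≡ F ⊎ H ≡ G)

-- A triangulation of a connected closed surface, described combinatorially
-- (a connected finite simplicial 2-complex in which every edge lies in
-- exactly two faces and the link of every vertex is a single cycle).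
record Triangulation : Set₁ where
  field
    n              : ℕ
    IsFace         : Subset n → Set
    face-size      : ∀ F → IsFace F → ∣ F ∣ ≡ 3
    vertex-in-face : ∀ v → ∃ λ F → IsFace F × v ∈ F
    edge-faces     : ∀ u w → u ≢ w → Adj IsFace u w → EdgeInTwoFaces IsFace u w
    link-connected : ∀ v u w → LinkVertex IsFace v u → LinkVertex IsFace v w →
                     Star (LinkAdj IsFace v) u w
    connected      : ∀ u w → Star (Adj IsFace) u w

-- Zigzags.  A zigzag e_i is encoded by its vertex walk v : ℤ → V with
-- e_i = (v i → v (i+1)).

infixl 6 _⊕_
_⊕_ : ℤ → ℕ → ℤ
i ⊕ k = i ℤ.+ (+ k)

module _ (T : Triangulation) where
  open Triangulation T

  shadow : (ℤ → Fin n) → ℤ → Subset n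
  shadow v i = tri (v i) (v (i ⊕ 1)) (v (i ⊕ 2))

  IsPeriod : (ℤ → Fin n) → ℕ → Set
  IsPeriod v p = 0 < p × (∀ i → v (i ⊕ p) ≡ v i)

  MinPeriod : (ℤ → Fin n) → ℕ → Set
  MinPeriod v p = IsPeriod v p × (∀ q → q < p → ¬ IsPeriod v q)

  IsZigzag : (ℤ → Fin n) → Set
  IsZigzag v =
    (∃ λ p → IsPeriod v p)
    × (∀ i → IsFace (shadow v i))
    × (∀ i → shadow v i ≢ shadow v (i ⊕ 1))
    -- e_i and e_{i+2} are disjoint
    × (∀ i → v i ≢ v (i ⊕ 2) × v i ≢ v (i ⊕ 3)
           × v (i ⊕ 1) ≢ v (i ⊕ 2) × v (i ⊕ 1) ≢ v (i ⊕ 3))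

  rev : (ℤ → Fin n) → (ℤ → Fin n)
  rev v i = v (- i)

  SameZigzag : (ℤ → Fin n) → (ℤ → Fin n) → Set
  SameZigzag v w = ∃ λ k → ∀ i → w i ≡ v (i ℤ.+ k)

  ShadowContains : (ℤ → Fin n) → Subset n → Set
  ShadowContains v F = ∃ λ i → shadow v i ≡ F

  EdgeIn : (ℤ → Fin n) → ℤ → Subset n → Set
  EdgeIn v j F = v j ∈ F × v (j ⊕ 1) ∈ F

  -- M_F is the identity: whenever e_i, e_{i+1} are consecutive oriented
  -- edges of F in a zigzag (so D_F(e_i) = e_{i+1}), the first element of
  -- Ω(F) occurring strictly after e_{i+1} is e_{i+1} itself.
  MonodromyIsId : Subset n → Set
  MonodromyIsId F =
    ∀ v → IsZigzag v → ∀ i → v i ∈ F → v (i ⊕ 1) ∈ F → v (i ⊕ 2) ∈ F →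
    ∀ m → EdgeIn v (i ⊕ 2 ⊕ m) F →
    (∀ m' → m' < m → ¬ EdgeIn v (i ⊕ 2 ⊕ m') F) →
    v (i ⊕ 2 ⊕ m) ≡ v (i ⊕ 1) × v (i ⊕ 2 ⊕ m ⊕ 1) ≡ v (i ⊕ 2)

  Adjacent : Subset n → Subset n → Set
  Adjacent F F' = IsFace F × IsFace F' × F ≢ F'
    × ∃₂ λ u w → u ≢ w × u ∈ F × w ∈ F × u ∈ F' × w ∈ F'

  -- the face shadow, read over one minimal period starting at index k, is
  --   F, F', …, F', …, F', F, …, F, …
  -- with F exactly at positions 0, b+1, c and F' exactly at 1, a, b.
  ShadowPattern : (ℤ → Fin n) → Subset n → Subset n → Set
  ShadowPattern v F F' =
    ∃ λ k → ∃ λ p → MinPeriod v p × ∃ λ a → ∃ λ b → ∃ λ c →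
      let sh : ℕ → Subset n
          sh j = shadow v (k ⊕ j)
      in (1 < a × a < b × suc b < c × c < p)
       × (sh 0 ≡ F × sh 1 ≡ F' × sh a ≡ F' × sh b ≡ F' × sh (suc b) ≡ F × sh c ≡ F)
       × (∀ j → j < p → sh j ≡ F → j ≡ 0 ⊎ j ≡ suc b ⊎ j ≡ c)
       × (∀ j → j < p → sh j ≡ F' → j ≡ 1 ⊎ j ≡ a ⊎ j ≡ b)

module Submission where

-- Since an edge lies in exactly two faces, a zigzag is
-- determined by any three consecutive vertices, forwards and backwards.

open import Data.Nat as ℕ using (ℕ; zero; suc; _≤_; _<_; s≤s; z≤n; _+_; _∸_; _*_)
import Data.Nat.Properties as ℕP
open import Data.Nat.Tactic.RingSolver as ℕSolver using ()
open import Data.Integer as ℤ using (ℤ; +_; -[1+_]; -_)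
import Data.Integer.Properties as ℤP
open import Data.Integer.Tactic.RingSolver using (solve-∀)
open import Data.Bool using (true; false)
open import Data.Vec using (_∷_; [])
open import Data.Fin using (Fin; toℕ; combine)
import Data.Fin.Properties as FinP
open import Data.Fin.Subset using (Subset; ⁅_⁆; _∪_; ∣_∣; _∈_; _∉_; _⊆_)
open import Data.Fin.Subset.Properties
  using (x∈p∪q⁻; x∈p∪q⁺; x∈⁅x⁆; x∈⁅y⁆⇒x≡y; ⊆-antisym; ∣⁅x⁆∣≡1; p⊂q⇒∣p∣<∣q∣; p⊆q⇒∣p∣≤∣q∣; q⊆p∪q; _∈?_)
open import Data.Product using (∃; _×_; _,_; proj₁; proj₂)
open import Data.Sum as Sum using (_⊎_; inj₁; inj₂; [_,_]′)
open import Data.Empty using (⊥-elim)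
open import Function using (case_of_)
open import Relation.Nullary using (¬_; Dec; yes; no)
open import Relation.Nullary.Decidable using (_×-dec_; ¬?)
open import Relation.Binary using (tri<; tri≈; tri>)
open import Relation.Binary.PropositionalEquality
open import Defs

∈-tri⁻ : ∀ {n} {t a b c : Fin n} → t ∈ tri a b c → t ≡ a ⊎ t ≡ b ⊎ t ≡ c
∈-tri⁻ {a = a} {b} {c} t∈abc with x∈p∪q⁻ ⁅ a ⁆ (⁅ b ⁆ ∪ ⁅ c ⁆) t∈abc
... | inj₁ t∈a  = inj₁ (x∈⁅y⁆⇒x≡y a t∈a)
... | inj₂ t∈bc = inj₂ (Sum.map (x∈⁅y⁆⇒x≡y b) (x∈⁅y⁆⇒x≡y c) (x∈p∪q⁻ ⁅ b ⁆ ⁅ c ⁆ t∈bc))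

∈-tri⁺ : ∀ {n} {t a b c : Fin n} → t ≡ a ⊎ t ≡ b ⊎ t ≡ c → t ∈ tri a b c
∈-tri⁺ {a = a} (inj₁ refl) = x∈p∪q⁺ (inj₁ (x∈⁅x⁆ a))
∈-tri⁺ {a = a} {b} (inj₂ (inj₁ refl)) = x∈p∪q⁺ {p = ⁅ a ⁆} (inj₂ (x∈p∪q⁺ (inj₁ (x∈⁅x⁆ b))))
∈-tri⁺ {a = a} {b} {c} (inj₂ (inj₂ refl)) = x∈p∪q⁺ {p = ⁅ a ⁆} (inj₂ (x∈p∪q⁺ {p = ⁅ b ⁆} (inj₂ (x∈⁅x⁆ c))))

∈-tri₁ : ∀ {n} {a b c : Fin n} → a ∈ tri a b c
∈-tri₁ = ∈-tri⁺ (inj₁ refl)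

∈-tri₂ : ∀ {n} {a b c : Fin n} → b ∈ tri a b c
∈-tri₂ = ∈-tri⁺ (inj₂ (inj₁ refl))

∈-tri₃ : ∀ {n} {a b c : Fin n} → c ∈ tri a b c
∈-tri₃ = ∈-tri⁺ (inj₂ (inj₂ refl))

tri-⊆ : ∀ {n} {a b c : Fin n} {G : Subset n} → a ∈ G → b ∈ G → c ∈ G → tri a b c ⊆ G
tri-⊆ a∈G b∈G c∈G t∈abc with ∈-tri⁻ t∈abc
... | inj₁ refl = a∈G
... | inj₂ (inj₁ refl) = b∈G
... | inj₂ (inj₂ refl) = c∈G

tri-rotate : ∀ {n} (a b c : Fin n) → tri a b c ≡ tri b c a
tri-rotate a b c = ⊆-antisym (tri-⊆ ∈-tri₃ ∈-tri₁ ∈-tri₂) (tri-⊆ ∈-tri₂ ∈-tri₃ ∈-tri₁)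

tri-reverse : ∀ {n} (a b c : Fin n) → tri a b c ≡ tri c b a
tri-reverse a b c = ⊆-antisym (tri-⊆ ∈-tri₃ ∈-tri₂ ∈-tri₁) (tri-⊆ ∈-tri₃ ∈-tri₂ ∈-tri₁)

tri-cong : ∀ {n} {a a' b b' c c' : Fin n} → a ≡ a' → b ≡ b' → c ≡ c' → tri a b c ≡ tri a' b' c'
tri-cong refl refl refl = refl

tri-third : ∀ {n} {a b c d : Fin n} → tri a b c ≡ tri a b d → c ≢ a → c ≢ b → c ≡ d
tri-third {c = c} eq c≢a c≢b with ∈-tri⁻ (subst (c ∈_) eq ∈-tri₃)
... | inj₁ c≡a = ⊥-elim (c≢a c≡a)
... | inj₂ (inj₁ c≡b) = ⊥-elim (c≢b c≡b)
... | inj₂ (inj₂ c≡d) = c≡d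

Cyclic : ∀ {n} (x y w a b c : Fin n) → Set
Cyclic x y w a b c = (x ≡ a × y ≡ b × w ≡ c) ⊎ (x ≡ b × y ≡ c × w ≡ a) ⊎ (x ≡ c × y ≡ a × w ≡ b)

tri-orderings : ∀ {n} {x y w a b c : Fin n} → x ∈ tri a b c → y ∈ tri a b c → w ∈ tri a b c →
  x ≢ y → y ≢ w → x ≢ w → Cyclic x y w a b c ⊎ Cyclic x y w c b a
tri-orderings x∈ y∈ w∈ x≢y y≢w x≢w with ∈-tri⁻ x∈ | ∈-tri⁻ y∈ | ∈-tri⁻ w∈
... | inj₁ refl | inj₂ (inj₁ refl) | inj₂ (inj₂ refl) = inj₁ (inj₁ (refl , refl , refl))
... | inj₂ (inj₁ refl) | inj₂ (inj₂ refl) | inj₁ refl = inj₁ (inj₂ (inj₁ (refl , refl , refl)))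
... | inj₂ (inj₂ refl) | inj₁ refl | inj₂ (inj₁ refl) = inj₁ (inj₂ (inj₂ (refl , refl , refl)))
... | inj₂ (inj₂ refl) | inj₂ (inj₁ refl) | inj₁ refl = inj₂ (inj₁ (refl , refl , refl))
... | inj₂ (inj₁ refl) | inj₁ refl | inj₂ (inj₂ refl) = inj₂ (inj₂ (inj₁ (refl , refl , refl)))
... | inj₁ refl | inj₂ (inj₂ refl) | inj₂ (inj₁ refl) = inj₂ (inj₂ (inj₂ (refl , refl , refl)))
... | inj₁ refl | inj₁ refl | _ = ⊥-elim (x≢y refl)
... | inj₂ (inj₁ refl) | inj₂ (inj₁ refl) | _ = ⊥-elim (x≢y refl)
... | inj₂ (inj₂ refl) | inj₂ (inj₂ refl) | _ = ⊥-elim (x≢y refl)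
... | _ | inj₁ refl | inj₁ refl = ⊥-elim (y≢w refl)
... | _ | inj₂ (inj₁ refl) | inj₂ (inj₁ refl) = ⊥-elim (y≢w refl)
... | _ | inj₂ (inj₂ refl) | inj₂ (inj₂ refl) = ⊥-elim (y≢w refl)
... | inj₁ refl | _ | inj₁ refl = ⊥-elim (x≢w refl)
... | inj₂ (inj₁ refl) | _ | inj₂ (inj₁ refl) = ⊥-elim (x≢w refl)
... | inj₂ (inj₂ refl) | _ | inj₂ (inj₂ refl) = ⊥-elim (x≢w refl)

∣p∪q∣≤∣p∣+∣q∣ : ∀ {n} (p q : Subset n) → ∣ p ∪ q ∣ ≤ ∣ p ∣ + ∣ q ∣
∣p∪q∣≤∣p∣+∣q∣ [] [] = z≤n
∣p∪q∣≤∣p∣+∣q∣ (false ∷ p) (false ∷ q) = ∣p∪q∣≤∣p∣+∣q∣ p q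
∣p∪q∣≤∣p∣+∣q∣ (false ∷ p) (true ∷ q) =
  subst (suc ∣ p ∪ q ∣ ≤_) (sym (ℕP.+-suc ∣ p ∣ ∣ q ∣)) (s≤s (∣p∪q∣≤∣p∣+∣q∣ p q))
∣p∪q∣≤∣p∣+∣q∣ (true ∷ p) (false ∷ q) = s≤s (∣p∪q∣≤∣p∣+∣q∣ p q)
∣p∪q∣≤∣p∣+∣q∣ (true ∷ p) (true ∷ q) =
  s≤s (subst (∣ p ∪ q ∣ ≤_) (sym (ℕP.+-suc ∣ p ∣ ∣ q ∣)) (ℕP.m≤n⇒m≤1+n (∣p∪q∣≤∣p∣+∣q∣ p q)))

∣⁅x⁆∪⁅y⁆∣≤2 : ∀ {n} (x y : Fin n) → ∣ ⁅ x ⁆ ∪ ⁅ y ⁆ ∣ ≤ 2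
∣⁅x⁆∪⁅y⁆∣≤2 x y = subst (∣ ⁅ x ⁆ ∪ ⁅ y ⁆ ∣ ≤_) (cong₂ _+_ (∣⁅x⁆∣≡1 x) (∣⁅x⁆∣≡1 y)) (∣p∪q∣≤∣p∣+∣q∣ ⁅ x ⁆ ⁅ y ⁆)

3≤∣tri∣ : ∀ {n} {a b c : Fin n} → a ≢ b → a ≢ c → b ≢ c → 3 ≤ ∣ tri a b c ∣
3≤∣tri∣ {a = a} {b} {c} a≢b a≢c b≢c =
  subst (λ k → suc (suc k) ≤ ∣ tri a b c ∣) (∣⁅x⁆∣≡1 c) (ℕP.≤-trans (s≤s c⊂bc) bc⊂abc)
  where
  c⊂bc : ∣ ⁅ c ⁆ ∣ < ∣ ⁅ b ⁆ ∪ ⁅ c ⁆ ∣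
  c⊂bc = p⊂q⇒∣p∣<∣q∣ (q⊆p∪q ⁅ b ⁆ ⁅ c ⁆ , b , x∈p∪q⁺ (inj₁ (x∈⁅x⁆ b)) , λ b∈c → b≢c (x∈⁅y⁆⇒x≡y c b∈c))
  bc⊂abc : ∣ ⁅ b ⁆ ∪ ⁅ c ⁆ ∣ < ∣ tri a b c ∣
  bc⊂abc = p⊂q⇒∣p∣<∣q∣ (q⊆p∪q ⁅ a ⁆ _ , a , ∈-tri₁ ,
    λ a∈bc → [ (λ a∈b → a≢b (x∈⁅y⁆⇒x≡y b a∈b)) , (λ a∈c → a≢c (x∈⁅y⁆⇒x≡y c a∈c)) ]′ (x∈p∪q⁻ ⁅ b ⁆ ⁅ c ⁆ a∈bc))

⊈⇒∃∉ : ∀ {n} {p q : Subset n} → ¬ p ⊆ q → ∃ λ x → x ∈ p × x ∉ q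
⊈⇒∃∉ {p = p} {q} p⊈q with FinP.any? (λ x → (x ∈? p) ×-dec ¬? (x ∈? q))
... | yes (x , x∈p , x∉q) = x , x∈p , x∉q
... | no ∄x = ⊥-elim (p⊈q p⊆q)
  where
  p⊆q : p ⊆ q
  p⊆q {x} x∈p with x ∈? q
  ... | yes x∈q = x∈q
  ... | no x∉q = ⊥-elim (∄x (x , x∈p , x∉q))

⊆-card-≡ : ∀ {n} {p q : Subset n} → p ⊆ q → ∣ q ∣ ≤ ∣ p ∣ → p ≡ q
⊆-card-≡ {p = p} {q} p⊆q ∣q∣≤∣p∣ = ⊆-antisym p⊆q q⊆p
  where
  q⊆p : q ⊆ p
  q⊆p {x} x∈q with x ∈? p
  ... | yes x∈p = x∈p
  ... | no x∉p = ⊥-elim (ℕP.<⇒≱ (p⊂q⇒∣p∣<∣q∣ (p⊆q , x , x∈q , x∉p)) ∣q∣≤∣p∣)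

three-set-as-tri : ∀ {n} (G : Subset n) {y z : Fin n} → ∣ G ∣ ≡ 3 → y ∈ G → z ∈ G → y ≢ z →
  ∃ λ u → u ≢ y × u ≢ z × G ≡ tri y z u
three-set-as-tri G {y} {z} ∣G∣≡3 y∈G z∈G y≢z = completed (⊈⇒∃∉ G⊈yz)
  where
  G⊈yz : ¬ G ⊆ (⁅ y ⁆ ∪ ⁅ z ⁆)
  G⊈yz G⊆yz = ℕP.<⇒≱ (ℕP.n<1+n 2)
    (subst (_≤ 2) ∣G∣≡3 (ℕP.≤-trans (p⊆q⇒∣p∣≤∣q∣ G⊆yz) (∣⁅x⁆∪⁅y⁆∣≤2 y z)))
  completed : (∃ λ u → u ∈ G × u ∉ ⁅ y ⁆ ∪ ⁅ z ⁆) → ∃ λ u → u ≢ y × u ≢ z × G ≡ tri y z u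
  completed (u , u∈G , u∉yz) =
    u , u≢y , u≢z , sym (⊆-card-≡ (tri-⊆ y∈G z∈G u∈G) (subst (_≤ _) (sym ∣G∣≡3) (3≤∣tri∣ y≢z (≢-sym u≢y) (≢-sym u≢z))))
    where
    u≢y : u ≢ y
    u≢y refl = u∉yz (x∈p∪q⁺ (inj₁ (x∈⁅x⁆ u)))
    u≢z : u ≢ z
    u≢z refl = u∉yz (x∈p∪q⁺ {p = ⁅ y ⁆} (inj₂ (x∈⁅x⁆ u)))

least-from : (Q : ℕ → Set) → (∀ m → Dec (Q m)) → ∀ a J → a ≤ J → Q J →
  ∃ λ j → a ≤ j × Q j × (∀ j' → a ≤ j' → j' < j → ¬ Q j')
least-from Q Q? a J a≤J QJ = search (J ∸ a) a (subst Q (sym (ℕP.m∸n+n≡m a≤J)) QJ)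
  where
  search : ∀ fuel a → Q (fuel + a) → ∃ λ j → a ≤ j × Q j × (∀ j' → a ≤ j' → j' < j → ¬ Q j')
  search fuel a Q-later with Q? a
  ... | yes Qa = a , ℕP.≤-refl , Qa , λ j' a≤j' j'<a _ → ℕP.<⇒≱ j'<a a≤j'
  search zero a Qa | no ¬Qa = ⊥-elim (¬Qa Qa)
  search (suc fuel) a Q-later | no ¬Qa with search fuel (suc a) (subst Q (sym (ℕP.+-suc fuel a)) Q-later)
  ... | j , a<j , Qj , below = j , ℕP.<⇒≤ a<j , Qj , below'
    where
    below' : ∀ j' → a ≤ j' → j' < j → ¬ Q j'
    below' j' a≤j' j'<j with ℕP.m≤n⇒m<n∨m≡n a≤j'
    ... | inj₁ a<j' = below j' a<j' j'<j
    ... | inj₂ refl = ¬Qa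

⊕-⊕ : ∀ i a b → i ⊕ a ⊕ b ≡ i ⊕ (b + a)
⊕-⊕ i a b = trans (ℤP.+-assoc i (+ a) (+ b)) (cong (λ k → i ⊕ k) (ℕP.+-comm a b))

⊕-identityʳ : ∀ i → i ⊕ 0 ≡ i
⊕-identityʳ = ℤP.+-identityʳ

module Local (T : Triangulation) where
  open Triangulation T

  FaceOn : Fin n → Fin n → Subset n → Set
  FaceOn q r K = IsFace K × q ∈ K × r ∈ K

  other-face-unique : ∀ {q r K K₁ K₂} → q ≢ r → FaceOn q r K → FaceOn q r K₁ → FaceOn q r K₂ →
    K₁ ≢ K → K₂ ≢ K → K₁ ≡ K₂
  other-face-unique {q} {r} {K} {K₁} {K₂} q≢r (isK , qK , rK) (isK₁ , qK₁ , rK₁) (isK₂ , qK₂ , rK₂) K₁≢K K₂≢K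
    with edge-faces q r q≢r (K , isK , qK , rK)
  ... | _ , _ , _ , _ , _ , _ , _ , only-two
    with only-two K isK qK rK | only-two K₁ isK₁ qK₁ rK₁ | only-two K₂ isK₂ qK₂ rK₂
  ... | inj₁ refl | inj₁ refl | _ = ⊥-elim (K₁≢K refl)
  ... | inj₂ refl | inj₂ refl | _ = ⊥-elim (K₁≢K refl)
  ... | inj₁ refl | _ | inj₁ refl = ⊥-elim (K₂≢K refl)
  ... | inj₂ refl | _ | inj₂ refl = ⊥-elim (K₂≢K refl)
  ... | inj₁ refl | inj₂ refl | inj₂ refl = refl
  ... | inj₂ refl | inj₁ refl | inj₁ refl = refl

  record ZStep (a₀ a₁ a₂ a₃ : Fin n) : Set where
    field
      face₀  : IsFace (tri a₀ a₁ a₂)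
      face₁  : IsFace (tri a₁ a₂ a₃)
      faces≢ : tri a₀ a₁ a₂ ≢ tri a₁ a₂ a₃
      a₀≢a₁  : a₀ ≢ a₁
      a₀≢a₂  : a₀ ≢ a₂
      a₀≢a₃  : a₀ ≢ a₃
      a₁≢a₂  : a₁ ≢ a₂
      a₁≢a₃  : a₁ ≢ a₃
      a₂≢a₃  : a₂ ≢ a₃

  ZStep-cong : ∀ {a₀ a₁ a₂ a₃ b₀ b₁ b₂ b₃} → a₀ ≡ b₀ → a₁ ≡ b₁ → a₂ ≡ b₂ → a₃ ≡ b₃ →
    ZStep a₀ a₁ a₂ a₃ → ZStep b₀ b₁ b₂ b₃
  ZStep-cong refl refl refl refl s = s

  -- A zigzag step is determined by its first three vertices: a₃ is the
  -- third vertex of the face on a₁a₂ other than a₀a₁a₂ ...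
  step-forward-unique : ∀ {a₀ a₁ a₂ a₃ b₃} → ZStep a₀ a₁ a₂ a₃ → ZStep a₀ a₁ a₂ b₃ → a₃ ≡ b₃
  step-forward-unique s t = tri-third
    (other-face-unique (ZStep.a₁≢a₂ s) (ZStep.face₀ s , ∈-tri₂ , ∈-tri₃)
      (ZStep.face₁ s , ∈-tri₁ , ∈-tri₂) (ZStep.face₁ t , ∈-tri₁ , ∈-tri₂)
      (≢-sym (ZStep.faces≢ s)) (≢-sym (ZStep.faces≢ t)))
    (≢-sym (ZStep.a₁≢a₃ s)) (≢-sym (ZStep.a₂≢a₃ s))

  step-backward-unique : ∀ {a₀ a₁ a₂ a₃ b₀} → ZStep a₀ a₁ a₂ a₃ → ZStep b₀ a₁ a₂ a₃ → a₀ ≡ b₀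
  step-backward-unique {a₀} {a₁} {a₂} {a₃} {b₀} s t = tri-third
    (trans (sym (tri-rotate a₀ a₁ a₂))
      (trans (other-face-unique (ZStep.a₁≢a₂ s) (ZStep.face₁ s , ∈-tri₁ , ∈-tri₂)
               (ZStep.face₀ s , ∈-tri₂ , ∈-tri₃) (ZStep.face₀ t , ∈-tri₂ , ∈-tri₃)
               (ZStep.faces≢ s) (ZStep.faces≢ t))
        (tri-rotate b₀ a₁ a₂)))
    (ZStep.a₀≢a₁ s) (ZStep.a₀≢a₂ s)

  step-reverse : ∀ {a₀ a₁ a₂ a₃} → ZStep a₀ a₁ a₂ a₃ → ZStep a₃ a₂ a₁ a₀
  step-reverse {a₀} {a₁} {a₂} {a₃} s = record
    { face₀ = subst IsFace (tri-reverse a₁ a₂ a₃) (ZStep.face₁ s)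
    ; face₁ = subst IsFace (tri-reverse a₀ a₁ a₂) (ZStep.face₀ s)
    ; faces≢ = λ eq → ZStep.faces≢ s
        (trans (tri-reverse a₀ a₁ a₂) (trans (sym eq) (sym (tri-reverse a₁ a₂ a₃))))
    ; a₀≢a₁ = ≢-sym (ZStep.a₂≢a₃ s) ; a₀≢a₂ = ≢-sym (ZStep.a₁≢a₃ s) ; a₀≢a₃ = ≢-sym (ZStep.a₀≢a₃ s)
    ; a₁≢a₂ = ≢-sym (ZStep.a₁≢a₂ s) ; a₁≢a₃ = ≢-sym (ZStep.a₀≢a₂ s) ; a₂≢a₃ = ≢-sym (ZStep.a₀≢a₁ s) }

  LocalZigzag : (ℤ → Fin n) → Set
  LocalZigzag v = ∀ i → ZStep (v i) (v (i ⊕ 1)) (v (i ⊕ 2)) (v (i ⊕ 3))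

  private
    pred⊕1 : ∀ i → (i ℤ.- + 1) ℤ.+ + 1 ≡ i
    pred⊕1 = solve-∀
    pred⊕2 : ∀ i → (i ℤ.- + 1) ℤ.+ + 2 ≡ i ℤ.+ + 1
    pred⊕2 = solve-∀

  shadow-next : ∀ v i → shadow T v (i ⊕ 1) ≡ tri (v (i ⊕ 1)) (v (i ⊕ 2)) (v (i ⊕ 3))
  shadow-next v i = cong₂ (tri (v (i ⊕ 1))) (cong v (⊕-⊕ i 1 1)) (cong v (⊕-⊕ i 1 2))

  -- A zigzag satisfies the local axioms (the window at i uses the zigzag
  -- conditions at i - 1, i and i + 1) ...
  zigzag-local : ∀ {v} → IsZigzag T v → LocalZigzag v
  zigzag-local {v} (_ , face , turn , apart) i = record
    { face₀ = face i
    ; face₁ = subst IsFace (shadow-next v i) (face (i ⊕ 1))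
    ; faces≢ = subst (shadow T v i ≢_) (shadow-next v i) (turn i)
    ; a₀≢a₁ = subst₂ (λ x y → v x ≢ v y) (pred⊕1 i) (pred⊕2 i) (proj₁ (proj₂ (proj₂ (apart (i ℤ.- + 1)))))
    ; a₀≢a₂ = proj₁ (apart i)
    ; a₀≢a₃ = proj₁ (proj₂ (apart i))
    ; a₁≢a₂ = proj₁ (proj₂ (proj₂ (apart i)))
    ; a₁≢a₃ = proj₂ (proj₂ (proj₂ (apart i)))
    ; a₂≢a₃ = subst₂ (λ x y → v x ≢ v y) (⊕-⊕ i 1 1) (⊕-⊕ i 1 2) (proj₁ (proj₂ (proj₂ (apart (i ⊕ 1)))))
    }

  local-zigzag : ∀ {v} → LocalZigzag v → (∃ λ p → IsPeriod T v p) → IsZigzag T v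
  local-zigzag {v} steps period =
    period ,
    (λ i → ZStep.face₀ (steps i)) ,
    (λ i → subst (shadow T v i ≢_) (sym (shadow-next v i)) (ZStep.faces≢ (steps i))) ,
    (λ i → ZStep.a₀≢a₂ (steps i) , ZStep.a₀≢a₃ (steps i) , ZStep.a₁≢a₂ (steps i) , ZStep.a₁≢a₃ (steps i))

  private
    shift-⊕ : ∀ i K a → (i ℤ.+ K) ℤ.+ a ≡ (i ℤ.+ a) ℤ.+ K
    shift-⊕ = solve-∀
    neg-⊕3 : ∀ i → - (i ℤ.+ + 3) ℤ.+ + 3 ≡ - i
    neg-⊕3 = solve-∀
    neg-⊕2 : ∀ i → - (i ℤ.+ + 3) ℤ.+ + 2 ≡ - (i ℤ.+ + 1)
    neg-⊕2 = solve-∀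
    neg-⊕1 : ∀ i → - (i ℤ.+ + 3) ℤ.+ + 1 ≡ - (i ℤ.+ + 2)
    neg-⊕1 = solve-∀

  local-shift : ∀ {v} → LocalZigzag v → ∀ K → LocalZigzag (λ i → v (i ℤ.+ K))
  local-shift {v} steps K i = ZStep-cong refl
    (cong v (shift-⊕ i K (+ 1))) (cong v (shift-⊕ i K (+ 2))) (cong v (shift-⊕ i K (+ 3)))
    (steps (i ℤ.+ K))

  local-rev : ∀ {v} → LocalZigzag v → LocalZigzag (rev T v)
  local-rev {v} steps i = ZStep-cong
    (cong v (neg-⊕3 i)) (cong v (neg-⊕2 i)) (cong v (neg-⊕1 i)) refl
    (step-reverse (steps (- (i ⊕ 3))))

  private
    back-⊕1 : ∀ j t → (j ℤ.- (+ 1 ℤ.+ t)) ℤ.+ + 1 ≡ j ℤ.- t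
    back-⊕1 = solve-∀
    back-⊕2 : ∀ j t → (j ℤ.- (+ 1 ℤ.+ t)) ℤ.+ + 2 ≡ (j ℤ.- t) ℤ.+ + 1
    back-⊕2 = solve-∀
    back-⊕3 : ∀ j t → (j ℤ.- (+ 1 ℤ.+ t)) ℤ.+ + 3 ≡ (j ℤ.- t) ℤ.+ + 2
    back-⊕3 = solve-∀
    split-at : ∀ j x → j ℤ.+ (x ℤ.- j) ≡ x
    split-at = solve-∀

  -- Determinism: two local zigzags that agree on three consecutive
  -- vertices agree everywhere (propagate forwards and backwards with the
  -- uniqueness of zigzag steps).
  module _ {v w : ℤ → Fin n} (steps-v : LocalZigzag v) (steps-w : LocalZigzag w) where

    Agree₃ : ℤ → Set
    Agree₃ i = v i ≡ w i × v (i ⊕ 1) ≡ w (i ⊕ 1) × v (i ⊕ 2) ≡ w (i ⊕ 2)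

    move : ∀ {i i'} → i ≡ i' → v i ≡ w i → v i' ≡ w i'
    move = subst (λ k → v k ≡ w k)

    agree-next : ∀ i → Agree₃ i → v (i ⊕ 3) ≡ w (i ⊕ 3)
    agree-next i (e₀ , e₁ , e₂) =
      step-forward-unique (steps-v i) (ZStep-cong (sym e₀) (sym e₁) (sym e₂) refl (steps-w i))

    agree-prev : ∀ i → v (i ⊕ 1) ≡ w (i ⊕ 1) → v (i ⊕ 2) ≡ w (i ⊕ 2) → v (i ⊕ 3) ≡ w (i ⊕ 3) →
      v i ≡ w i
    agree-prev i e₁ e₂ e₃ =
      step-backward-unique (steps-v i) (ZStep-cong refl (sym e₁) (sym e₂) (sym e₃) (steps-w i))

    agree-everywhere : ∀ j → Agree₃ j → ∀ x → v x ≡ w x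
    agree-everywhere j agree x = move (split-at j x) (proj₁ (from (x ℤ.- j)))
      where
      forwards : ∀ t → Agree₃ (j ⊕ t)
      forwards zero = subst Agree₃ (sym (⊕-identityʳ j)) agree
      forwards (suc t) with forwards t
      ... | e₀ , e₁ , e₂ =
        move (⊕-⊕ j t 1) e₁ , move (slide 1) e₂ , move (slide 2) (agree-next (j ⊕ t) (e₀ , e₁ , e₂))
        where
        slide : ∀ a → j ⊕ t ⊕ suc a ≡ j ⊕ suc t ⊕ a
        slide a = trans (⊕-⊕ j t (suc a)) (trans (cong (j ⊕_) (sym (ℕP.+-suc a t))) (sym (⊕-⊕ j (suc t) a)))
      backwards : ∀ t → Agree₃ (j ℤ.- + t)
      backwards zero = subst Agree₃ (sym (⊕-identityʳ j)) agree
      backwards (suc t) with backwards t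
      ... | e₀ , e₁ , e₂ =
        agree-prev (j ℤ.- + suc t) e₀' e₁' (move (sym (back-⊕3 j (+ t))) e₂) , e₀' , e₁'
        where
        e₀' : v (j ℤ.- + suc t ⊕ 1) ≡ w (j ℤ.- + suc t ⊕ 1)
        e₀' = move (sym (back-⊕1 j (+ t))) e₀
        e₁' : v (j ℤ.- + suc t ⊕ 2) ≡ w (j ℤ.- + suc t ⊕ 2)
        e₁' = move (sym (back-⊕2 j (+ t))) e₁
      from : ∀ d → Agree₃ (j ℤ.+ d)
      from (+ t) = forwards t
      from -[1+ t ] = backwards (suc t)

  private
    offset : ∀ j t a → (j ℤ.+ a) ℤ.+ (t ℤ.- j) ≡ t ℤ.+ a
    offset = solve-∀

  same-zigzag-from : ∀ {v w} → LocalZigzag v → LocalZigzag w → ∀ t j →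
    v t ≡ w j → v (t ⊕ 1) ≡ w (j ⊕ 1) → v (t ⊕ 2) ≡ w (j ⊕ 2) → SameZigzag T v w
  same-zigzag-from {v} steps-v steps-w t j e₀ e₁ e₂ =
    t ℤ.- j , λ i → sym (agree-everywhere (local-shift steps-v (t ℤ.- j)) steps-w j
      (trans (cong v (split-at j t)) e₀ ,
       trans (cong v (offset j t (+ 1))) e₁ ,
       trans (cong v (offset j t (+ 2))) e₂) i)

private
  regroup : ∀ P a k → a + P * suc k ≡ a + P * k + P
  regroup = ℕSolver.solve-∀

module Existence (T : Triangulation) where
  open Triangulation T
  open Local T

  record Flag : Set where
    constructor flag
    field
      x y z : Fin n
      face  : IsFace (tri x y z)
      x≢y   : x ≢ y
      y≢z   : y ≢ z
      x≢z   : x ≢ z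
  open Flag

  -- Across the edge yz of a flag lies the second face y z u through yz;
  -- x y z u is then a zigzag step.  (Kept opaque: only this specification
  -- is used, and unfolding the construction makes type checking costly.)
  opaque
    across : (s : Flag) → ∃ λ u → ZStep (x s) (y s) (z s) u
    across (flag x y z face x≢y y≢z x≢z) with edge-faces y z y≢z (tri x y z , face , ∈-tri₂ , ∈-tri₃)
    ... | K₁ , K₂ , K₁≢K₂ , face₁ , face₂ , (y∈K₁ , z∈K₁) , (y∈K₂ , z∈K₂) , only-two =
      complete other-face
      where
      other-face : ∃ λ K → IsFace K × K ≢ tri x y z × y ∈ K × z ∈ K
      other-face with only-two (tri x y z) face ∈-tri₂ ∈-tri₃
      ... | inj₁ refl = K₂ , face₂ , ≢-sym K₁≢K₂ , y∈K₂ , z∈K₂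
      ... | inj₂ refl = K₁ , face₁ , K₁≢K₂ , y∈K₁ , z∈K₁
      complete : (∃ λ K → IsFace K × K ≢ tri x y z × y ∈ K × z ∈ K) → ∃ λ u → ZStep x y z u
      complete (K , isK , K≢xyz , y∈K , z∈K) with three-set-as-tri K (face-size K isK) y∈K z∈K y≢z
      ... | u , u≢y , u≢z , refl = u , record
        { face₀ = face ; face₁ = isK ; faces≢ = ≢-sym K≢xyz
        ; a₀≢a₁ = x≢y ; a₀≢a₂ = x≢z ; a₀≢a₃ = x≢u ; a₁≢a₂ = y≢z ; a₁≢a₃ = ≢-sym u≢y ; a₂≢a₃ = ≢-sym u≢z }
        where
        x≢u : x ≢ u
        x≢u refl = K≢xyz (sym (tri-rotate x y z))

  next : Flag → Flag
  next s = flag (y s) (z s) (proj₁ (across s))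
    (ZStep.face₁ step) (y≢z s) (ZStep.a₂≢a₃ step) (ZStep.a₁≢a₃ step)
    where step = proj₂ (across s)

  module Walk (start : Flag) where
    flags : ℕ → Flag
    flags zero = start
    flags (suc k) = next (flags k)

    w : ℕ → Fin n
    w k = x (flags k)

    w-step : ∀ k → ZStep (w k) (w (suc k)) (w (suc (suc k))) (w (suc (suc (suc k))))
    w-step k = proj₂ (across (flags k))

    Same₃ : ℕ → ℕ → Set
    Same₃ a b = w a ≡ w b × w (suc a) ≡ w (suc b) × w (suc (suc a)) ≡ w (suc (suc b))

    same₃-next : ∀ {a b} → Same₃ a b → Same₃ (suc a) (suc b)
    same₃-next {a} {b} (e₀ , e₁ , e₂) =
      e₁ , e₂ , step-forward-unique (w-step a) (ZStep-cong (sym e₀) (sym e₁) (sym e₂) refl (w-step b))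

    same₃-prev : ∀ {a b} → Same₃ (suc a) (suc b) → Same₃ a b
    same₃-prev {a} {b} (e₁ , e₂ , e₃) =
      step-backward-unique (w-step a) (ZStep-cong refl (sym e₁) (sym e₂) (sym e₃) (w-step b)) , e₁ , e₂

    same₃-from-start : ∀ a d → Same₃ a (a + d) → Same₃ 0 d
    same₃-from-start zero d same = same
    same₃-from-start (suc a) d same = same₃-from-start a d (same₃-prev {a} {a + d} same)

    triple-code : ℕ → Fin (n * (n * n))
    triple-code k = combine (w k) (combine (w (suc k)) (w (suc (suc k))))

    -- There are finitely many triples of vertices, so some triple repeats
    -- (pigeonhole); walking back, the start triple itself repeats.
    returns : ∃ λ P → 0 < P × Same₃ 0 P
    returns with FinP.pigeonhole (ℕP.n<1+n (n * (n * n))) (λ i → triple-code (toℕ i))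
    ... | i , j , i<j , same-code with FinP.combine-injective _ _ _ _ same-code
    ... | e₀ , e₁₂ with FinP.combine-injective _ _ _ _ e₁₂
    ... | e₁ , e₂ = toℕ j ∸ toℕ i , ℕP.m<n⇒0<n∸m i<j ,
      same₃-from-start (toℕ i) (toℕ j ∸ toℕ i)
        (subst (Same₃ (toℕ i)) (sym (ℕP.m+[n∸m]≡n (ℕP.<⇒≤ i<j))) (e₀ , e₁ , e₂))

    -- Once the start triple repeats after P steps, the walk is P-periodic
    -- and extends to a zigzag indexed by ℤ.
    module Periodic (P : ℕ) (P-pos : 0 < P) (P-return : Same₃ 0 P) where
      same₃-shift : ∀ m → Same₃ m (m + P)
      same₃-shift zero = P-return
      same₃-shift (suc m) = same₃-next (same₃-shift m)

      w-periodic : ∀ a k → w (a + P * k) ≡ w a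
      w-periodic a zero = cong w (trans (cong (λ m → a + m) (ℕP.*-zeroʳ P)) (ℕP.+-identityʳ a))
      w-periodic a (suc k) = begin
        w (a + P * suc k)   ≡⟨ cong w (regroup P a k) ⟩
        w (a + P * k + P)   ≡⟨ sym (proj₁ (same₃-shift (a + P * k))) ⟩
        w (a + P * k)       ≡⟨ w-periodic a k ⟩
        w a                 ∎
        where open ≡-Reasoning

      -- A natural-number representative of i modulo P: rep i = i + P·|i|.
      rep : ℤ → ℕ
      rep (+ k) = k + P * k
      rep -[1+ k ] = P * suc k ∸ suc k

      rep-correct : ∀ i → + rep i ≡ i ℤ.+ + (P * ℤ.∣ i ∣)
      rep-correct (+ k) = refl
      rep-correct -[1+ k ] = sym (ℤP.⊖-≥ (ℕP.m≤n*m (suc k) P {{ℕ.>-nonZero P-pos}}))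

      v : ℤ → Fin n
      v i = w (rep i)

      private
        shift-rep : ∀ (i t x y : ℤ) → ((i ℤ.+ t) ℤ.+ y) ℤ.+ x ≡ (t ℤ.+ (i ℤ.+ x)) ℤ.+ y
        shift-rep = solve-∀

      v-shift : ∀ i t → v (i ⊕ t) ≡ w (t + rep i)
      v-shift i t = begin
        w (rep (i ⊕ t))                         ≡⟨ sym (w-periodic (rep (i ⊕ t)) ℤ.∣ i ∣) ⟩
        w (rep (i ⊕ t) + P * ℤ.∣ i ∣)           ≡⟨ cong w (ℤP.+-injective same-integer) ⟩
        w (t + rep i + P * ℤ.∣ i ⊕ t ∣)         ≡⟨ w-periodic (t + rep i) ℤ.∣ i ⊕ t ∣ ⟩
        w (t + rep i)                           ∎
        where
        open ≡-Reasoning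
        same-integer : + (rep (i ⊕ t) + P * ℤ.∣ i ∣) ≡ + (t + rep i + P * ℤ.∣ i ⊕ t ∣)
        same-integer = trans (cong (ℤ._+ + (P * ℤ.∣ i ∣)) (rep-correct (i ⊕ t)))
          (trans (shift-rep i (+ t) (+ (P * ℤ.∣ i ∣)) (+ (P * ℤ.∣ i ⊕ t ∣)))
            (cong (λ r → (+ t ℤ.+ r) ℤ.+ + (P * ℤ.∣ i ⊕ t ∣)) (sym (rep-correct i))))

      -- Each window of v is a window of the walk, hence a zigzag step.
      v-steps : LocalZigzag v
      v-steps i = ZStep-cong refl (sym (v-shift i 1)) (sym (v-shift i 2)) (sym (v-shift i 3)) (w-step (rep i))

      v-zigzag : IsZigzag T v
      v-zigzag = local-zigzag v-steps (P , P-pos , P-period)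
        where
        P-period : ∀ i → v (i ⊕ P) ≡ v i
        P-period i = trans (v-shift i P) (trans (cong w (ℕP.+-comm P (rep i))) (sym (proj₁ (same₃-shift (rep i)))))

      v-start : ∀ k → v (+ k) ≡ w k
      v-start k = w-periodic k k

  zigzag-from : (s : Flag) → ∃ λ v → IsZigzag T v × v (+ 0) ≡ x s × v (+ 1) ≡ y s × v (+ 2) ≡ z s
  zigzag-from s with Walk.returns s
  ... | P , P-pos , P-return = v , v-zigzag , v-start 0 , v-start 1 , v-start 2
    where open Walk.Periodic s P P-pos P-return

module Visits (T : Triangulation) where
  open Triangulation T
  open Local T

  module From {v : ℤ → Fin n} (v-zigzag : IsZigzag T v) (k : ℤ) where
    v-steps : LocalZigzag v
    v-steps = zigzag-local v-zigzag

    u : ℕ → Fin n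
    u t = v (k ⊕ t)

    face-at : ℕ → Subset n
    face-at t = tri (u t) (u (suc t)) (u (suc (suc t)))

    ⊕-from : ∀ a b → k ⊕ a ⊕ b ≡ k ⊕ (a + b)
    ⊕-from a b = trans (⊕-⊕ k a b) (cong (k ⊕_) (ℕP.+-comm b a))

    u-step : ∀ t → ZStep (u t) (u (suc t)) (u (suc (suc t))) (u (suc (suc (suc t))))
    u-step t = ZStep-cong refl (cong v (⊕-⊕ k t 1)) (cong v (⊕-⊕ k t 2)) (cong v (⊕-⊕ k t 3)) (v-steps (k ⊕ t))

    shadow-face-at : ∀ t → shadow T v (k ⊕ t) ≡ face-at t
    shadow-face-at t = cong₂ (tri (u t)) (cong v (⊕-⊕ k t 1)) (cong v (⊕-⊕ k t 2))

    period-from : ∀ q → 0 < q → u q ≡ u 0 → u (suc q) ≡ u 1 → u (suc (suc q)) ≡ u 2 → IsPeriod T v q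
    period-from q q-pos e₀ e₁ e₂ = q-pos , agree-everywhere (local-shift v-steps (+ q)) v-steps k
      (trans e₀ (cong v (⊕-identityʳ k)) , trans (cong v (⊕-from 1 q)) e₁ , trans (cong v (⊕-from 2 q)) e₂)

    Returns : ℕ → Set
    Returns q = 0 < q × u q ≡ u 0 × u (suc q) ≡ u 1 × u (suc (suc q)) ≡ u 2

    returns? : ∀ q → Dec (Returns q)
    returns? q = (0 ℕP.<? q) ×-dec ((u q FinP.≟ u 0) ×-dec ((u (suc q) FinP.≟ u 1) ×-dec (u (suc (suc q)) FinP.≟ u 2)))

    period-returns : ∀ {q} → IsPeriod T v q → Returns q
    period-returns {q} (q-pos , periodic) = q-pos , trans (periodic k) (cong v (sym (⊕-identityʳ k))) ,
      trans (cong v (sym (⊕-from 1 q))) (periodic (k ⊕ 1)) , trans (cong v (sym (⊕-from 2 q))) (periodic (k ⊕ 2))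

    -- Every zigzag has a minimal period (the least q at which its first
    -- three vertices return).  Opaque for the same reason as across.
    opaque
      min-period : ∃ λ p → MinPeriod T v p
      min-period with proj₁ v-zigzag
      ... | P , P-period with least-from Returns returns? 0 P z≤n (period-returns P-period)
      ... | p , _ , (p-pos , e₀ , e₁ , e₂) , below =
        p , period-from p p-pos e₀ e₁ e₂ , λ q q<p q-period → below q z≤n q<p (period-returns q-period)

    module Monodromy (G : Subset n) (mono : MonodromyIsId T G) where

      GEdge : ℕ → Set
      GEdge j = u j ∈ G × u (suc j) ∈ G

      GEdge? : ∀ j → Dec (GEdge j)
      GEdge? j = (u j ∈? G) ×-dec (u (suc j) ∈? G)

      visit-members : ∀ {t} → face-at t ≡ G → u t ∈ G × u (suc t) ∈ G × u (suc (suc t)) ∈ G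
      visit-members visit = subst (_ ∈_) visit ∈-tri₁ , subst (_ ∈_) visit ∈-tri₂ , subst (_ ∈_) visit ∈-tri₃

      first-edge-returns : ∀ t → face-at t ≡ G → ∀ j → suc (suc t) ≤ j → GEdge j →
        (∀ j' → suc (suc t) ≤ j' → j' < j → ¬ GEdge j') →
        u j ≡ u (suc t) × u (suc j) ≡ u (suc (suc t))
      first-edge-returns t visit-t j t₂≤j edge-j first =
        via (j ∸ suc (suc t)) (ℕP.m+[n∸m]≡n t₂≤j) edge-j first
        where
        ut∈G : u t ∈ G
        ut∈G = proj₁ (visit-members visit-t)
        ut₁∈G : u (suc t) ∈ G
        ut₁∈G = proj₁ (proj₂ (visit-members visit-t))
        ut₂∈G : u (suc (suc t)) ∈ G
        ut₂∈G = proj₂ (proj₂ (visit-members visit-t))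
        at : ∀ m → k ⊕ t ⊕ 2 ⊕ m ≡ k ⊕ (suc (suc t) + m)
        at m = trans (cong (_⊕ m) (⊕-⊕ k t 2)) (⊕-from (suc (suc t)) m)
        at₁ : ∀ m → k ⊕ t ⊕ 2 ⊕ m ⊕ 1 ≡ k ⊕ suc (suc (suc t) + m)
        at₁ m = trans (cong (_⊕ 1) (at m)) (⊕-⊕ k _ 1)
        in-G : ∀ {i i'} → i ≡ i' → v i ∈ G → v i' ∈ G
        in-G i≡i' = subst (_∈ G) (cong v i≡i')
        via : ∀ m → suc (suc t) + m ≡ j → GEdge j → (∀ j' → suc (suc t) ≤ j' → j' < j → ¬ GEdge j') →
          u j ≡ u (suc t) × u (suc j) ≡ u (suc (suc t))
        via m refl (uj∈G , uj₁∈G) first =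
          trans (cong v (sym (at m))) (trans (proj₁ returned) (cong v (⊕-⊕ k t 1))) ,
          trans (cong v (sym (at₁ m))) (trans (proj₂ returned) (cong v (⊕-⊕ k t 2)))
          where
          returned : v (k ⊕ t ⊕ 2 ⊕ m) ≡ v (k ⊕ t ⊕ 1) × v (k ⊕ t ⊕ 2 ⊕ m ⊕ 1) ≡ v (k ⊕ t ⊕ 2)
          returned = mono v v-zigzag (k ⊕ t) ut∈G (in-G (sym (⊕-⊕ k t 1)) ut₁∈G) (in-G (sym (⊕-⊕ k t 2)) ut₂∈G) m
            (in-G (sym (at m)) uj∈G , in-G (sym (at₁ m)) uj₁∈G)
            (λ m' m'<m (e₀ , e₁) → first (suc (suc t) + m') (ℕP.m≤m+n _ m') (ℕP.+-monoʳ-< (suc (suc t)) m'<m)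
               (in-G (at m') e₀ , in-G (at₁ m') e₁))

      record NextVisit (t : ℕ) : Set where
        field
          j      : ℕ
          later  : suc (suc (suc t)) ≤ j
          same₀  : u j ≡ u (suc t)
          same₁  : u (suc j) ≡ u (suc (suc t))
          same₂  : u (suc (suc j)) ≡ u t
          visit  : face-at j ≡ G
          no-visit : ∀ j' → t < j' → j' < j → face-at j' ≢ G
          no-edge  : ∀ j' → suc (suc t) ≤ j' → j' < j → ¬ GEdge j'

      -- If the first G-edge after a visit at t is u(t+1) → u(t+2) again at
      -- position j ≥ t+3, then G is the face at j: the face at j-1 is not
      -- G (its edge at j-1 would be an earlier G-edge), and an edge lies in
      -- only two faces.
      re-entry : ∀ t → face-at t ≡ G → ∀ j → suc (suc (suc t)) ≤ j →
        (∀ j' → suc (suc t) ≤ j' → j' < j → ¬ GEdge j') →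
        u j ≡ u (suc t) → u (suc j) ≡ u (suc (suc t)) → NextVisit t
      re-entry t visit-t (suc i) (s≤s t₂≤i) first e₀ e₁ = record
        { j = suc i ; later = s≤s t₂≤i ; same₀ = e₀ ; same₁ = e₁ ; same₂ = e₂
        ; visit = sym G≡face ; no-visit = no-visit ; no-edge = first }
        where
        edge-members : u t ∈ G × u (suc t) ∈ G × u (suc (suc t)) ∈ G
        edge-members = visit-members visit-t
        G≡face : G ≡ face-at (suc i)
        G≡face = other-face-unique (ZStep.a₁≢a₂ (u-step t))
          (ZStep.face₀ (u-step i) , subst (_∈ face-at i) e₀ ∈-tri₂ , subst (_∈ face-at i) e₁ ∈-tri₃)
          (subst IsFace visit-t (ZStep.face₀ (u-step t)) , proj₁ (proj₂ edge-members) , proj₂ (proj₂ edge-members))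
          (ZStep.face₀ (u-step (suc i)) , subst (_∈ face-at (suc i)) e₀ ∈-tri₁ , subst (_∈ face-at (suc i)) e₁ ∈-tri₂)
          (λ G≡i → first i t₂≤i ℕP.≤-refl (subst (_ ∈_) (sym G≡i) ∈-tri₁ , subst (_ ∈_) (sym G≡i) ∈-tri₂))
          (≢-sym (ZStep.faces≢ (u-step i)))
        e₂ : u (suc (suc (suc i))) ≡ u t
        e₂ with ∈-tri⁻ (subst (_ ∈_) (trans (sym G≡face) (sym visit-t)) ∈-tri₃)
        ... | inj₁ same = same
        ... | inj₂ (inj₁ same) = ⊥-elim (ZStep.a₀≢a₂ (u-step (suc i)) (trans e₀ (sym same)))
        ... | inj₂ (inj₂ same) = ⊥-elim (ZStep.a₁≢a₂ (u-step (suc i)) (trans e₁ (sym same)))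
        no-visit : ∀ j' → t < j' → j' < suc i → face-at j' ≢ G
        no-visit j' t<j' j'<j visit-j' with ℕP.m≤n⇒m<n∨m≡n t<j'
        ... | inj₁ t₁<j' = first j' t₁<j' j'<j (proj₁ (visit-members visit-j') , proj₁ (proj₂ (visit-members visit-j')))
        ... | inj₂ refl = ZStep.faces≢ (u-step t) (trans visit-t (sym visit-j'))

      -- After each visit to G there is a next one, provided some later
      -- G-edge exists (the first one is where the zigzag re-enters G).
      -- Opaque: only the NextVisit record is used, never the search.
      opaque
        next-visit : ∀ t → face-at t ≡ G → ∀ J → suc (suc t) ≤ J → GEdge J → NextVisit t
        next-visit t visit-t J t₂≤J edge-J with least-from GEdge GEdge? (suc (suc t)) J t₂≤J edge-J
        ... | j , t₂≤j , edge-j , first with first-edge-returns t visit-t j t₂≤j edge-j first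
        ... | e₀ , e₁ with ℕP.m≤n⇒m<n∨m≡n t₂≤j
        ... | inj₁ t₃≤j = re-entry t visit-t j t₃≤j first e₀ e₁
        ... | inj₂ refl = ⊥-elim (ZStep.a₁≢a₂ (u-step t) (sym e₀))

      Reads : ℕ → Fin n → Fin n → Fin n → Set
      Reads t a b c = u t ≡ a × u (suc t) ≡ b × u (suc (suc t)) ≡ c

      record ThreeVisits (p : ℕ) : Set where
        field
          d₁ d₂  : ℕ
          3≤d₁   : 3 ≤ d₁
          d₁<d₂  : d₁ < d₂
          d₂<p   : d₂ < p
          reads₁ : Reads d₁ (u 1) (u 2) (u 0)
          reads₂ : Reads d₂ (u 2) (u 0) (u 1)
          visit₁ : face-at d₁ ≡ G
          visit₂ : face-at d₂ ≡ G
          only   : ∀ j → j < p → face-at j ≡ G → j ≡ 0 ⊎ j ≡ d₁ ⊎ j ≡ d₂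

      three-visits : ∀ {p} → MinPeriod T v p → face-at 0 ≡ G → ThreeVisits p
      three-visits {p} ((p-pos , periodic) , minimal) visit₀ = record
        { d₁ = d₁ ; d₂ = d₂ ; 3≤d₁ = NextVisit.later N₁
        ; d₁<d₂ = ℕP.<-trans (ℕP.n<1+n d₁) (ℕP.<-trans (ℕP.n<1+n (suc d₁)) (NextVisit.later N₂))
        ; d₂<p = d₂<p ; reads₁ = reads₁ ; reads₂ = reads₂
        ; visit₁ = NextVisit.visit N₁ ; visit₂ = NextVisit.visit N₂ ; only = only }
        where
        open ZStep (u-step 0) using (a₀≢a₁; a₀≢a₂)
        u-periodic : ∀ t → u (t + p) ≡ u t
        u-periodic t = trans (cong v (sym (⊕-from t p))) (periodic (k ⊕ t))
        -- the edge u p → u (p+1) is the first edge u 0 → u 1 again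
        edge-p : GEdge p
        edge-p = subst (_∈ G) (sym (u-periodic 0)) (proj₁ (visit-members visit₀)) ,
                 subst (_∈ G) (sym (u-periodic 1)) (proj₁ (proj₂ (visit-members visit₀)))
        2≤p : 2 ≤ p
        2≤p = ℕP.≤∧≢⇒< p-pos (λ 1≡p → a₀≢a₁ (sym (trans (cong u 1≡p) (u-periodic 0))))
        not-p : ∀ {j} → u j ≢ u 0 → j ≢ p
        not-p uj≢u0 refl = uj≢u0 (u-periodic 0)
        before-p : ∀ {t} (N : NextVisit t) → suc (suc t) ≤ p → u (NextVisit.j N) ≢ u 0 → NextVisit.j N < p
        before-p N t₂≤p uj≢u0 = ℕP.≤∧≢⇒< (ℕP.≮⇒≥ (λ p<j → NextVisit.no-edge N p t₂≤p p<j edge-p)) (not-p uj≢u0)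
        N₁ : NextVisit 0
        N₁ = next-visit 0 visit₀ p 2≤p edge-p
        d₁ : ℕ
        d₁ = NextVisit.j N₁
        reads₁ : Reads d₁ (u 1) (u 2) (u 0)
        reads₁ = NextVisit.same₀ N₁ , NextVisit.same₁ N₁ , NextVisit.same₂ N₁
        d₁<p : d₁ < p
        d₁<p = before-p N₁ 2≤p (λ e → a₀≢a₁ (trans (sym e) (NextVisit.same₀ N₁)))
        d₁₊₁<p : suc d₁ < p
        d₁₊₁<p = ℕP.≤∧≢⇒< d₁<p (not-p (λ e → a₀≢a₂ (trans (sym e) (NextVisit.same₁ N₁))))
        N₂ : NextVisit d₁
        N₂ = next-visit d₁ (NextVisit.visit N₁) p d₁₊₁<p edge-p
        d₂ : ℕ
        d₂ = NextVisit.j N₂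
        reads₂ : Reads d₂ (u 2) (u 0) (u 1)
        reads₂ = trans (NextVisit.same₀ N₂) (NextVisit.same₁ N₁) , trans (NextVisit.same₁ N₂) (NextVisit.same₂ N₁) ,
                 trans (NextVisit.same₂ N₂) (NextVisit.same₀ N₁)
        d₂<p : d₂ < p
        d₂<p = before-p N₂ d₁₊₁<p (λ e → a₀≢a₂ (trans (sym e) (proj₁ reads₂)))
        -- a third visit would read u 0, u 1, u 2 again, i.e. be a period,
        -- so it does not happen before p
        no-third-visit : ∀ j → d₂ < j → j < p → face-at j ≢ G
        no-third-visit j d₂<j j<p with next-visit d₂ (NextVisit.visit N₂) p (ℕP.≤-trans (s≤s d₂<j) j<p) edge-p
        ... | N₃ with ℕP.<-cmp (NextVisit.j N₃) p
        ... | tri< d₃<p _ _ = ⊥-elim (minimal (NextVisit.j N₃) d₃<p (period-from (NextVisit.j N₃)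
                (ℕP.≤-trans (s≤s z≤n) (NextVisit.later N₃)) (trans (NextVisit.same₀ N₃) (proj₁ (proj₂ reads₂)))
                (trans (NextVisit.same₁ N₃) (proj₂ (proj₂ reads₂))) (trans (NextVisit.same₂ N₃) (proj₁ reads₂))))
        ... | tri≈ _ d₃≡p _ = NextVisit.no-visit N₃ j d₂<j (subst (j <_) (sym d₃≡p) j<p)
        ... | tri> _ _ p<d₃ = NextVisit.no-visit N₃ j d₂<j (ℕP.<-trans j<p p<d₃)
        only : ∀ j → j < p → face-at j ≡ G → j ≡ 0 ⊎ j ≡ d₁ ⊎ j ≡ d₂
        only zero _ _ = inj₁ refl
        only (suc j) j<p visit with ℕP.<-cmp (suc j) d₁
        ... | tri< j<d₁ _ _ = ⊥-elim (NextVisit.no-visit N₁ (suc j) (s≤s z≤n) j<d₁ visit)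
        ... | tri≈ _ j≡d₁ _ = inj₂ (inj₁ j≡d₁)
        ... | tri> _ _ d₁<j with ℕP.<-cmp (suc j) d₂
        ...   | tri< j<d₂ _ _ = ⊥-elim (NextVisit.no-visit N₂ (suc j) d₁<j j<d₂ visit)
        ...   | tri≈ _ j≡d₂ _ = inj₂ (inj₂ j≡d₂)
        ...   | tri> _ _ d₂<j = ⊥-elim (no-third-visit (suc j) d₂<j j<p visit)

private
  rev-⊕1 : ∀ (d : ℤ) → - (- (+ 2 ℤ.+ d) ℤ.+ + 1) ≡ + 1 ℤ.+ d
  rev-⊕1 = solve-∀
  rev-⊕2 : ∀ (d : ℤ) → - (- (+ 2 ℤ.+ d) ℤ.+ + 2) ≡ d
  rev-⊕2 = solve-∀

module Uniqueness (T : Triangulation) where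
  open Triangulation T
  open Local T
  open Visits T

  -- A zigzag through a face G with trivial z-monodromy is, up to shift and
  -- reversal, the only zigzag through G: it reads all six orderings of
  -- the vertices of G (three forwards, three backwards), and a zigzag is
  -- determined by three consecutive vertices.
  zigzag-unique : ∀ {v} → IsZigzag T v → ∀ {G} → shadow T v (+ 0) ≡ G → MonodromyIsId T G →
    ∀ w → IsZigzag T w → ShadowContains T w G → SameZigzag T v w ⊎ SameZigzag T (rev T v) w
  zigzag-unique {v} v-zigzag {G} shadow₀ mono w w-zigzag (j , shadow-j) =
    Sum.map forwards backwards (tri-orderings (in-G ∈-tri₁) (in-G ∈-tri₂) (in-G ∈-tri₃)
      (ZStep.a₀≢a₁ (w-steps j)) (ZStep.a₁≢a₂ (w-steps j)) (ZStep.a₀≢a₂ (w-steps j)))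
    where
    open From v-zigzag (+ 0)
    open Monodromy G mono
    visit₀ : face-at 0 ≡ G
    visit₀ = trans (sym (shadow-face-at 0)) shadow₀
    visits : ThreeVisits (proj₁ min-period)
    visits = three-visits (proj₂ min-period) visit₀
    open ThreeVisits visits using (d₁; d₂; reads₁; reads₂)
    w-steps : LocalZigzag w
    w-steps = zigzag-local w-zigzag
    x y z : Fin n
    x = w j
    y = w (j ⊕ 1)
    z = w (j ⊕ 2)
    in-G : ∀ {t} → t ∈ shadow T w j → t ∈ face-at 0
    in-G = subst (_ ∈_) (trans shadow-j (sym visit₀))
    v-at : ∀ d a → v (+ d ⊕ a) ≡ u (a + d)
    v-at d a = cong (λ m → v (+ m)) (ℕP.+-comm d a)
    from-reads : ∀ d {a b c} → Reads d a b c → x ≡ a → y ≡ b → z ≡ c → SameZigzag T v w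
    from-reads d (e₀ , e₁ , e₂) x≡a y≡b z≡c = same-zigzag-from v-steps w-steps (+ d) j
      (trans e₀ (sym x≡a)) (trans (v-at d 1) (trans e₁ (sym y≡b))) (trans (v-at d 2) (trans e₂ (sym z≡c)))
    from-reads-rev : ∀ d {a b c} → Reads d a b c → x ≡ c → y ≡ b → z ≡ a → SameZigzag T (rev T v) w
    from-reads-rev d (e₀ , e₁ , e₂) x≡c y≡b z≡a = same-zigzag-from (local-rev v-steps) w-steps (- (+ (2 + d))) j
      (trans e₂ (sym x≡c)) (trans (cong v (rev-⊕1 (+ d))) (trans e₁ (sym y≡b)))
      (trans (cong v (rev-⊕2 (+ d))) (trans e₀ (sym z≡a)))
    start : Reads 0 (u 0) (u 1) (u 2)
    start = refl , refl , refl
    forwards : Cyclic x y z (u 0) (u 1) (u 2) → SameZigzag T v w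
    forwards (inj₁ (x≡ , y≡ , z≡)) = from-reads 0 start x≡ y≡ z≡
    forwards (inj₂ (inj₁ (x≡ , y≡ , z≡))) = from-reads d₁ reads₁ x≡ y≡ z≡
    forwards (inj₂ (inj₂ (x≡ , y≡ , z≡))) = from-reads d₂ reads₂ x≡ y≡ z≡
    backwards : Cyclic x y z (u 2) (u 1) (u 0) → SameZigzag T (rev T v) w
    backwards (inj₁ (x≡ , y≡ , z≡)) = from-reads-rev 0 start x≡ y≡ z≡
    backwards (inj₂ (inj₁ (x≡ , y≡ , z≡))) = from-reads-rev d₂ reads₂ x≡ y≡ z≡
    backwards (inj₂ (inj₂ (x≡ , y≡ , z≡))) = from-reads-rev d₁ reads₁ x≡ y≡ z≡

  module Pattern {v} (v-zigzag : IsZigzag T v) {G G'} (shadow₀ : shadow T v (+ 0) ≡ G)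
    (shadow₁ : shadow T v (+ 1) ≡ G') (mono : MonodromyIsId T G) (mono' : MonodromyIsId T G') where

    module V = From v-zigzag (+ 0)
    module V' = From v-zigzag (+ 1)
    module M = V.Monodromy G mono
    module M' = V'.Monodromy G' mono'
    p : ℕ
    p = proj₁ V.min-period
    visits : M.ThreeVisits p
    visits = M.three-visits (proj₂ V.min-period) (trans (sym (V.shadow-face-at 0)) shadow₀)
    visits' : M'.ThreeVisits p
    visits' = M'.three-visits (proj₂ V.min-period) (trans (sym (V'.shadow-face-at 0)) shadow₁)
    open M.ThreeVisits visits using (d₁; d₂; 3≤d₁; d₁<d₂; d₂<p; reads₁; visit₁; visit₂; only)
    open M'.ThreeVisits visits' using () renaming
      (d₁ to e₁; d₂ to e₂; 3≤d₁ to 3≤e₁; d₁<d₂ to e₁<e₂; reads₁ to reads'₁;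
       visit₁ to visit'₁; visit₂ to visit'₂; only to only')

    G≢G' : G ≢ G'
    G≢G' G≡G' = proj₁ (proj₂ (proj₂ v-zigzag)) (+ 0) (trans shadow₀ (trans G≡G' (sym shadow₁)))

    -- The face just before the second visit to G is G' (it is the other
    -- face on the edge v 1 v 2), and it is the last visit to G'.
    second-visit-after-last' : d₁ ≡ suc (suc e₂)
    second-visit-after-last' = after (only' i i<p face-i)
      where
      i : ℕ
      i = d₁ ∸ 2
      d₁≡i₂ : d₁ ≡ suc (suc i)
      d₁≡i₂ = sym (ℕP.m+[n∸m]≡n (ℕP.<⇒≤ 3≤d₁))
      i<p : i < p
      i<p = ℕP.<-trans (ℕP.<-trans (ℕP.n<1+n i) (ℕP.n<1+n (suc i))) (subst (_< p) d₁≡i₂ (ℕP.<-trans d₁<d₂ d₂<p))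
      reads-i : V.u (suc (suc i)) ≡ V.u 1 × V.u (suc (suc (suc i))) ≡ V.u 2
      reads-i = subst (λ d → V.u d ≡ V.u 1 × V.u (suc d) ≡ V.u 2) d₁≡i₂ (proj₁ reads₁ , proj₁ (proj₂ reads₁))
      face-i : V'.face-at i ≡ G'
      face-i = sym (other-face-unique (ZStep.a₁≢a₂ (V.u-step 0))
        (subst IsFace shadow₀ (ZStep.face₀ (V.u-step 0)) , subst (_ ∈_) shadow₀ ∈-tri₂ , subst (_ ∈_) shadow₀ ∈-tri₃)
        (subst IsFace shadow₁ (ZStep.face₀ (V'.u-step 0)) , subst (_ ∈_) shadow₁ ∈-tri₁ , subst (_ ∈_) shadow₁ ∈-tri₂)
        (ZStep.face₀ (V'.u-step i) ,
         subst (_∈ V'.face-at i) (proj₁ reads-i) ∈-tri₂ , subst (_∈ V'.face-at i) (proj₂ reads-i) ∈-tri₃)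
        (≢-sym G≢G')
        (λ face-i≡G → ZStep.faces≢ (V.u-step (suc i))
          (trans face-i≡G (sym (subst (λ d → V.face-at d ≡ G) d₁≡i₂ visit₁)))))
      after : i ≡ 0 ⊎ i ≡ e₁ ⊎ i ≡ e₂ → d₁ ≡ suc (suc e₂)
      after (inj₁ i≡0) = ⊥-elim (ℕP.<⇒≱ (subst (3 ≤_) d₁≡i₂ 3≤d₁) (ℕP.≤-reflexive (cong (λ m → suc (suc m)) i≡0)))
      after (inj₂ (inj₁ i≡e₁)) = ⊥-elim (ZStep.a₁≢a₃ (V.u-step 0)
        (trans (sym (proj₁ reads-i)) (trans (cong (λ m → V.u (suc (suc m))) i≡e₁) (proj₁ (proj₂ reads'₁)))))
      after (inj₂ (inj₂ i≡e₂)) = trans d₁≡i₂ (cong (λ m → suc (suc m)) i≡e₂)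

    -- Read from position 0: G at 0, G' at 1, G' at e₁+1, G' at e₂+1,
    -- G at e₂+2 = d₁, G at d₂, and nowhere else within the period.
    shadow-pattern : ShadowPattern T v G G'
    shadow-pattern = + 0 , p , proj₂ V.min-period , suc e₁ , suc e₂ , d₂ ,
      (s≤s (ℕP.≤-trans (s≤s z≤n) 3≤e₁) , s≤s e₁<e₂ , subst (_< d₂) second-visit-after-last' d₁<d₂ , d₂<p) ,
      (trans (V.shadow-face-at 0) visit₀ , shadow₁ ,
       trans (V'.shadow-face-at e₁) visit'₁ , trans (V'.shadow-face-at e₂) visit'₂ ,
       trans (V.shadow-face-at _) (subst (λ d → V.face-at d ≡ G) second-visit-after-last' visit₁) ,
       trans (V.shadow-face-at d₂) visit₂) ,
      G-only , G'-only
      where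
      visit₀ : V.face-at 0 ≡ G
      visit₀ = trans (sym (V.shadow-face-at 0)) shadow₀
      G-only : ∀ j → j < p → shadow T v (+ 0 ⊕ j) ≡ G → j ≡ 0 ⊎ j ≡ suc (suc e₂) ⊎ j ≡ d₂
      G-only j j<p visit with only j j<p (trans (sym (V.shadow-face-at j)) visit)
      ... | inj₁ j≡0 = inj₁ j≡0
      ... | inj₂ (inj₁ j≡d₁) = inj₂ (inj₁ (trans j≡d₁ second-visit-after-last'))
      ... | inj₂ (inj₂ j≡d₂) = inj₂ (inj₂ j≡d₂)
      G'-only : ∀ j → j < p → shadow T v (+ 0 ⊕ j) ≡ G' → j ≡ 1 ⊎ j ≡ suc e₁ ⊎ j ≡ suc e₂
      G'-only zero _ visit = ⊥-elim (G≢G' (trans (sym shadow₀) visit))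
      G'-only (suc j) j<p visit =
        Sum.map (cong suc) (Sum.map (cong suc) (cong suc))
          (only' j (ℕP.<-trans (ℕP.n<1+n j) j<p) (trans (sym (V'.shadow-face-at j)) visit))

-- Two adjacent faces F, F' are consecutive faces of some zigzag: start
-- with F read as c, a, b (ab the common edge); the zigzag then crosses ab
-- into the other face on it, which is F'.
zigzag-across : (T : Triangulation) → ∀ {F F'} → Adjacent T F F' →
  ∃ λ v → IsZigzag T v × shadow T v (+ 0) ≡ F × shadow T v (+ 1) ≡ F'
zigzag-across T {F} {F'} (isF , isF' , F≢F' , a , b , a≢b , a∈F , b∈F , a∈F' , b∈F') =
  start (three-set-as-tri F (face-size F isF) a∈F b∈F a≢b)
  where
  open Triangulation T
  open Local T
  open Existence T
  Goal : Set
  Goal = ∃ λ v → IsZigzag T v × shadow T v (+ 0) ≡ F × shadow T v (+ 1) ≡ F'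
  start : (∃ λ c → c ≢ a × c ≢ b × F ≡ tri a b c) → Goal
  start (c , c≢a , c≢b , F≡abc) = cross (zigzag-from (flag c a b (subst IsFace F≡cab isF) c≢a a≢b c≢b))
    where
    F≡cab : F ≡ tri c a b
    F≡cab = trans F≡abc (sym (tri-rotate c a b))
    cross : (∃ λ v → IsZigzag T v × v (+ 0) ≡ c × v (+ 1) ≡ a × v (+ 2) ≡ b) → Goal
    cross (v , v-zigzag@(_ , face , turn , _) , v₀ , v₁ , v₂) = v , v-zigzag , shadow₀ ,
      sym (other-face-unique a≢b (isF , a∈F , b∈F) (isF' , a∈F' , b∈F')
        (face (+ 1) , subst (_∈ _) v₁ ∈-tri₁ , subst (_∈ _) v₂ ∈-tri₂)
        (≢-sym F≢F') (λ F≡shadow₁ → turn (+ 0) (trans shadow₀ (sym F≡shadow₁))))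
      where
      shadow₀ : shadow T v (+ 0) ≡ F
      shadow₀ = trans (tri-cong v₀ v₁ v₂) (sym F≡cab)

lemma2 : (T : Triangulation) → (F F' : Subset (Triangulation.n T)) →
    Adjacent T F F' → MonodromyIsId T F → MonodromyIsId T F' →
    ∃ λ v → IsZigzag T v × ShadowContains T v F × ShadowContains T v F'
      × (∀ w → IsZigzag T w → ShadowContains T w F → ShadowContains T w F' →
           SameZigzag T v w ⊎ SameZigzag T (rev T v) w)
      × (ShadowPattern T v F F' ⊎ ShadowPattern T (rev T v) F F')
lemma2 T F F' adjacent mono mono' = case zigzag-across T adjacent of λ where
  (v , v-zigzag , shadow₀ , shadow₁) →
    v , v-zigzag , (+ 0 , shadow₀) , (+ 1 , shadow₁) ,
    (λ w w-zigzag through-F _ → Uniqueness.zigzag-unique T v-zigzag shadow₀ mono w w-zigzag through-F) ,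
    inj₁ (Uniqueness.Pattern.shadow-pattern T v-zigzag shadow₀ shadow₁ mono mono')
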